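{- Let $G$ be a graph on $n=2m\ge 4$ vertices. If $G$ or its complement $\overline{G}$ is isomorphic to $mK_2$ (the disjoint union of $m$ copies of $K_2$), then for every vertex $v$, $$DV_G(v)+DV_{\overline{G}}(v)=n-1+2^{\frac n2-1}.$$
   Context: All graphs are finite, simple and undirected. $\overline{G}$ is the complement of $G$: same vertex set, with $uv$ an edge iff $uv$ is not an edge of $G$. A set $D\subseteq V(G)$ is a dominating set of $G$ if every vertex not in $D$ is adjacent to at least one vertex of $D$. The domination number $\gamma(G)$ is the minimum cardinality of a dominating set; a dominating set of cardinality $\gamma(G)$ is a $\gamma(G)$-set. For $v\in V(G)$, $DV_G(v)$ is the number of $\gamma(G)$-sets containing $v$. -}

module Defs where

open import Data.Bool using (Bool; true; false; not; _∧_; _∨_; if_then_else_)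
open import Data.Nat using (ℕ; zero; suc; _+_; _*_; _⊓_)
open import Data.Fin using (Fin; quotient)
open import Data.Fin.Properties using (_≟_)
open import Data.Vec using (Vec; []; _∷_; lookup)
open import Data.List using (List; []; _∷_; map; _++_; length; filterᵇ; foldr)
open import Data.Fin.Subset using (Subset; ∣_∣)
open import Relation.Nullary.Decidable using (⌊_⌋)
open import Relation.Binary.PropositionalEquality using (_≡_; refl; sym; cong)
open import Relation.Nullary using (yes; no)
open import Data.Empty using (⊥-elim)
open import Function.Bundles using (_↔_; Inverse)

record Graph (n : ℕ) : Set where
  field
    adj   : Fin n → Fin n → Bool
    adj-sym : ∀ u v → adj u v ≡ adj v u
    adj-irrefl : ∀ v → adj v v ≡ false
open Graph public

complement : ∀ {n} → Graph n → Graph n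
complement G = record
  { adj = λ u v → not (⌊ u ≟ v ⌋) ∧ not (adj G u v)
  ; adj-sym = λ u v → symC u v
  ; adj-irrefl = λ v → irrC v }
  where
  open import Relation.Binary.PropositionalEquality using (refl; sym; cong₂)
  open import Relation.Nullary using (yes; no)
  symC : ∀ u v → (not ⌊ u ≟ v ⌋ ∧ not (adj G u v)) ≡ (not ⌊ v ≟ u ⌋ ∧ not (adj G v u))
  symC u v with u ≟ v | v ≟ u
  ... | yes _ | yes _ = refl
  ... | yes refl | no ¬p = Data.Empty.⊥-elim (¬p refl) where import Data.Empty
  ... | no ¬p | yes refl = Data.Empty.⊥-elim (¬p refl) where import Data.Empty
  ... | no _ | no _ = cong₂ _∧_ refl (cong not (Graph.adj-sym G u v))
    where open import Relation.Binary.PropositionalEquality using (cong)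
  irrC : ∀ v → (not ⌊ v ≟ v ⌋ ∧ not (adj G v v)) ≡ false
  irrC v with v ≟ v
  ... | yes _ = refl
  ... | no ¬p = Data.Empty.⊥-elim (¬p refl) where import Data.Empty

_≅_ : ∀ {n} → Graph n → Graph n → Set
_≅_ {n} G H = Σ (Fin n ↔ Fin n) λ f →
  ∀ u v → adj G u v ≡ adj H (Inverse.to f u) (Inverse.to f v)
  where open import Data.Product using (Σ)

-- Vertices u, v of Fin (m * 2) lie in the same pair {2k, 2k+1}.
sameBlock : ∀ {m} → Fin (m * 2) → Fin (m * 2) → Bool
sameBlock {m} u v = ⌊ quotient {m} 2 u ≟ quotient {m} 2 v ⌋

sameBlock-sym : ∀ {m} (u v : Fin (m * 2)) → sameBlock {m} u v ≡ sameBlock {m} v u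
sameBlock-sym {m} u v with quotient {m} 2 u ≟ quotient {m} 2 v | quotient {m} 2 v ≟ quotient {m} 2 u
... | yes _ | yes _ = refl
... | no _ | no _ = refl
... | yes e | no ¬q = ⊥-elim (¬q (sym e))
... | no ¬q | yes e = ⊥-elim (¬q (sym e))

mK₂ : (m : ℕ) → Graph (m * 2)
mK₂ m = record
  { adj = λ u v → not ⌊ u ≟ v ⌋ ∧ sameBlock {m} u v
  ; adj-sym = symK ; adj-irrefl = irrK }
  where
  symK : ∀ u v → (not ⌊ u ≟ v ⌋ ∧ sameBlock {m} u v) ≡ (not ⌊ v ≟ u ⌋ ∧ sameBlock {m} v u)
  symK u v with u ≟ v | v ≟ u
  ... | yes _ | yes _ = refl
  ... | yes refl | no ¬p = ⊥-elim (¬p refl)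
  ... | no ¬p | yes refl = ⊥-elim (¬p refl)
  ... | no _ | no _ = cong (true ∧_) (sameBlock-sym {m} u v)
  irrK : ∀ v → (not ⌊ v ≟ v ⌋ ∧ sameBlock {m} v v) ≡ false
  irrK v with v ≟ v
  ... | yes _ = refl
  ... | no ¬p = ⊥-elim (¬p refl)

_∈ᵇ_ : ∀ {n} → Fin n → Subset n → Bool
v ∈ᵇ D = lookup D v

anyFin : ∀ {n} → (Fin n → Bool) → Bool
anyFin {zero} p = false
anyFin {suc n} p = p Fin.zero ∨ anyFin (λ i → p (Fin.suc i))
  where import Data.Fin as Fin

allFin : ∀ {n} → (Fin n → Bool) → Bool
allFin {zero} p = true
allFin {suc n} p = p Fin.zero ∧ allFin (λ i → p (Fin.suc i))
  where import Data.Fin as Fin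

isDominating : ∀ {n} → Graph n → Subset n → Bool
isDominating G D = allFin (λ v → v ∈ᵇ D ∨ anyFin (λ u → u ∈ᵇ D ∧ adj G v u))

allSubsets : ∀ n → List (Subset n)
allSubsets zero = [] ∷ []
allSubsets (suc n) = map (true ∷_) (allSubsets n) ++ map (false ∷_) (allSubsets n)

dominatingSets : ∀ {n} → Graph n → List (Subset n)
dominatingSets {n} G = filterᵇ (isDominating G) (allSubsets n)

-- Domination number: minimum cardinality of a dominating set
-- (the full vertex set is dominating, so n is an upper bound).
γ : ∀ {n} → Graph n → ℕ
γ {n} G = foldr (λ D k → ∣ D ∣ ⊓ k) n (dominatingSets G)

γSets : ∀ {n} → Graph n → List (Subset n)
γSets G = filterᵇ (λ D → ⌊ ∣ D ∣ Data.Nat.≟ γ G ⌋) (dominatingSets G)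
  where import Data.Nat

DV : ∀ {n} → Graph n → Fin n → ℕ
DV G v = length (filterᵇ (v ∈ᵇ_) (γSets G))

-- Isomorphisms preserve γ and carry γ-sets to γ-sets, so it suffices to take G = m K₂ or its
-- complement. A dominating set of m K₂ must meet each of the m pairs, so γ = m and the γ-sets are
-- the 2^m transversals of the pairs, 2^(m-1) of which contain v. In the complement every vertex is
-- adjacent to all but its partner, so two vertices dominate and one does not: γ = 2, the γ-sets are
-- the 2-subsets, and n - 1 of them contain v.
module Submission where

open import Defs
open import Data.Bool using (Bool; true; false; T; not; _∧_; _∨_; _xor_)
import Data.Bool.Properties as Bool
open import Data.Empty using (⊥-elim)
open import Data.Fin as Fin using (Fin; zero; suc; quotient)
open import Data.Fin.Properties using (suc-injective)
open import Data.Fin.Subset using (Subset; ∣_∣; ⊥)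
import Data.Fin.Subset.Properties as Subset
open import Data.List as List using (List; []; _∷_; _++_; length; filterᵇ; foldr)
import Data.List.Properties as List
open import Data.List.Membership.Propositional using (_∈_)
import Data.List.Membership.Propositional.Properties as ∈
open import Data.List.Membership.Propositional.Properties.WithK using (unique∧set⇒bag)
open import Data.List.Relation.Binary.BagAndSetEquality using (∼bag⇒↭)
open import Data.List.Relation.Binary.Permutation.Propositional using (_↭_; ↭-sym)
open import Data.List.Relation.Binary.Permutation.Propositional.Properties using (↭-length; filter-↭)
open import Data.List.Relation.Unary.All using ([])
open import Data.List.Relation.Unary.AllPairs using ([]; _∷_)
open import Data.List.Relation.Unary.Any using (here; there)
open import Data.List.Relation.Unary.Unique.Propositional using (Unique)
import Data.List.Relation.Unary.Unique.Propositional.Properties as Unique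
open import Data.Nat as ℕ using (ℕ; zero; suc; _+_; _*_; _∸_; _^_; _≤_; _≤ᵇ_; _⊓_; z≤n; s≤s)
import Data.Nat.Properties as ℕ
open import Data.Nat.Combinatorics using (_C_; nC1≡n; nCk+nC[k+1]≡[n+1]C[k+1])
open import Data.Product using (∃; _×_; _,_; proj₁; proj₂)
open import Data.Sum using (_⊎_; inj₁; inj₂)
open import Data.Vec as Vec using ([]; _∷_; lookup; tabulate)
import Data.Vec.Properties as Vec
open import Function using (_∘_; id; _⇔_; Equivalence; mk⇔; _↔_; Inverse; mk↔ₛ′)
open import Function.Definitions using (Injective)
open import Function.Properties.Inverse using (↔-sym; ↔⇒↣)
open import Function.Bundles using (Injection)
open import Relation.Binary.Definitions using (DecidableEquality)
open import Relation.Binary.PropositionalEquality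
  using (_≡_; _≢_; refl; sym; trans; cong; cong₂; subst; module ≡-Reasoning)
open import Relation.Nullary using (¬_)
open import Relation.Nullary.Decidable using (⌊_⌋; yes; no; T?)

open Inverse using (to; from)

⌊≟⌋-injective : ∀ {A B : Set} (_≟ᴬ_ : DecidableEquality A) (_≟ᴮ_ : DecidableEquality B)
  {f : A → B} → Injective _≡_ _≡_ f → ∀ x y → ⌊ f x ≟ᴮ f y ⌋ ≡ ⌊ x ≟ᴬ y ⌋
⌊≟⌋-injective _≟ᴬ_ _≟ᴮ_ {f} inj x y with x ≟ᴬ y | f x ≟ᴮ f y
... | yes _ | yes _ = refl
... | no _ | no _ = refl
... | yes refl | no fx≢fx = ⊥-elim (fx≢fx refl)
... | no x≢y | yes fx≡fy = ⊥-elim (x≢y (inj fx≡fy))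

⌊≟⌋≡false : ∀ {A : Set} (_≟_ : DecidableEquality A) {x y} → x ≢ y → ⌊ x ≟ y ⌋ ≡ false
⌊≟⌋≡false _≟_ {x} {y} x≢y with x ≟ y
... | yes x≡y = ⊥-elim (x≢y x≡y)
... | no _ = refl

⌊suc≟suc⌋ : ∀ {n} (i j : Fin n) → ⌊ suc i Fin.≟ suc j ⌋ ≡ ⌊ i Fin.≟ j ⌋
⌊suc≟suc⌋ = ⌊≟⌋-injective Fin._≟_ Fin._≟_ suc-injective

⌊suc≟suc⌋ℕ : ∀ m n → ⌊ suc m ℕ.≟ suc n ⌋ ≡ ⌊ m ℕ.≟ n ⌋
⌊suc≟suc⌋ℕ = ⌊≟⌋-injective ℕ._≟_ ℕ._≟_ ℕ.suc-injective

T-⇔⇒≡ : ∀ {x y} → T x ⇔ T y → x ≡ y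
T-⇔⇒≡ {false} {false} _ = refl
T-⇔⇒≡ {false} {true} x⇔y = ⊥-elim (Equivalence.from x⇔y _)
T-⇔⇒≡ {true} {false} x⇔y = ⊥-elim (Equivalence.to x⇔y _)
T-⇔⇒≡ {true} {true} _ = refl

countᵇ : {A : Set} → (A → Bool) → List A → ℕ
countᵇ p xs = length (filterᵇ p xs)

module _ {A : Set} where

  countᵇ-++ : ∀ (p : A → Bool) xs ys → countᵇ p (xs ++ ys) ≡ countᵇ p xs + countᵇ p ys
  countᵇ-++ p xs ys =
    trans (cong length (List.filter-++ (T? ∘ p) xs ys)) (List.length-++ (filterᵇ p xs))

  countᵇ-map : ∀ {B : Set} (p : B → Bool) (f : A → B) xs →
    countᵇ p (List.map f xs) ≡ countᵇ (p ∘ f) xs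
  countᵇ-map p f [] = refl
  countᵇ-map p f (x ∷ xs) with p (f x)
  ... | true = cong suc (countᵇ-map p f xs)
  ... | false = countᵇ-map p f xs

  countᵇ-cong : ∀ {p q : A → Bool} → (∀ x → p x ≡ q x) → ∀ xs → countᵇ p xs ≡ countᵇ q xs
  countᵇ-cong e [] = refl
  countᵇ-cong {p} {q} e (x ∷ xs) with p x | q x | e x
  ... | true | true | _ = cong suc (countᵇ-cong e xs)
  ... | false | false | _ = countᵇ-cong e xs

  countᵇ-none : ∀ {p : A → Bool} → (∀ x → p x ≡ false) → ∀ xs → countᵇ p xs ≡ 0
  countᵇ-none e [] = refl
  countᵇ-none {p} e (x ∷ xs) with p x | e x
  ... | false | _ = countᵇ-none e xs

  countᵇ-filterᵇ : ∀ (q p : A → Bool) xs → countᵇ p (filterᵇ q xs) ≡ countᵇ (λ x → q x ∧ p x) xs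
  countᵇ-filterᵇ q p [] = refl
  countᵇ-filterᵇ q p (x ∷ xs) with q x
  ... | false = countᵇ-filterᵇ q p xs
  ... | true with p x
  ...   | true = cong suc (countᵇ-filterᵇ q p xs)
  ...   | false = countᵇ-filterᵇ q p xs

  countᵇ-↭ : ∀ (p : A → Bool) {xs ys} → xs ↭ ys → countᵇ p xs ≡ countᵇ p ys
  countᵇ-↭ p xs↭ys = ↭-length (filter-↭ (T? ∘ p) xs↭ys)

  -- A bijection permutes a duplicate-free list of all elements.
  countᵇ-↔ : ∀ (p : A → Bool) {xs} → Unique xs → (∀ x → x ∈ xs) → (σ : A ↔ A) →
    countᵇ p xs ≡ countᵇ (p ∘ to σ) xs
  countᵇ-↔ p {xs} unique complete σ =
    trans (countᵇ-↭ p (↭-sym map↭)) (countᵇ-map p (to σ) xs)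
    where
    map↭ : List.map (to σ) xs ↭ xs
    map↭ = ∼bag⇒↭ (unique∧set⇒bag (Unique.map⁺ (Injection.injective (↔⇒↣ σ)) unique) unique
      (λ {x} → mk⇔ (λ _ → complete x)
        (λ _ → subst (_∈ List.map (to σ) xs) (Inverse.strictlyInverseˡ σ x)
                     (∈.∈-map⁺ (to σ) (complete (from σ x))))))

allFin⁺ : ∀ {n} (p : Fin n → Bool) → (∀ i → T (p i)) → T (allFin p)
allFin⁺ {zero} p h = _
allFin⁺ {suc n} p h = Equivalence.from Bool.T-∧ (h zero , allFin⁺ (p ∘ suc) (h ∘ suc))

allFin⁻ : ∀ {n} (p : Fin n → Bool) → T (allFin p) → ∀ i → T (p i)
allFin⁻ {suc n} p h zero = proj₁ (Equivalence.to Bool.T-∧ h)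
allFin⁻ {suc n} p h (suc i) = allFin⁻ (p ∘ suc) (proj₂ (Equivalence.to Bool.T-∧ h)) i

anyFin⁺ : ∀ {n} (p : Fin n → Bool) i → T (p i) → T (anyFin p)
anyFin⁺ {suc n} p zero h = Equivalence.from Bool.T-∨ (inj₁ h)
anyFin⁺ {suc n} p (suc i) h = Equivalence.from Bool.T-∨ (inj₂ (anyFin⁺ (p ∘ suc) i h))

anyFin⁻ : ∀ {n} (p : Fin n → Bool) → T (anyFin p) → ∃ λ i → T (p i)
anyFin⁻ {suc n} p h with Equivalence.to Bool.T-∨ h
... | inj₁ h₀ = zero , h₀
... | inj₂ h₁ with anyFin⁻ (p ∘ suc) h₁
...   | i , hᵢ = suc i , hᵢ

allFin-cong : ∀ {n} {p q : Fin n → Bool} → (∀ i → p i ≡ q i) → allFin p ≡ allFin q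
allFin-cong {zero} e = refl
allFin-cong {suc n} e = cong₂ _∧_ (e zero) (allFin-cong (e ∘ suc))

anyFin-cong : ∀ {n} {p q : Fin n → Bool} → (∀ i → p i ≡ q i) → anyFin p ≡ anyFin q
anyFin-cong {zero} e = refl
anyFin-cong {suc n} e = cong₂ _∨_ (e zero) (anyFin-cong (e ∘ suc))

allFin-all : ∀ {n} {p : Fin n → Bool} → (∀ i → p i ≡ true) → allFin p ≡ true
allFin-all {zero} e = refl
allFin-all {suc n} e = cong₂ _∧_ (e zero) (allFin-all (e ∘ suc))

anyFin-none : ∀ {n} {p : Fin n → Bool} → (∀ i → p i ≡ false) → anyFin p ≡ false
anyFin-none {zero} e = refl
anyFin-none {suc n} e = cong₂ _∨_ (e zero) (anyFin-none (e ∘ suc))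

module _ {n} (σ : Fin n ↔ Fin n) where

  allFin-↔ : ∀ (p : Fin n → Bool) → allFin p ≡ allFin (p ∘ to σ)
  allFin-↔ p = T-⇔⇒≡ (mk⇔
    (λ h → allFin⁺ (p ∘ to σ) (allFin⁻ p h ∘ to σ))
    (λ h → allFin⁺ p (λ j → subst (T ∘ p) (Inverse.strictlyInverseˡ σ j) (allFin⁻ (p ∘ to σ) h (from σ j)))))

  anyFin-↔ : ∀ (p : Fin n → Bool) → anyFin p ≡ anyFin (p ∘ to σ)
  anyFin-↔ p = T-⇔⇒≡ (mk⇔
    (λ h → let j , hⱼ = anyFin⁻ p h in
      anyFin⁺ (p ∘ to σ) (from σ j) (subst (T ∘ p) (sym (Inverse.strictlyInverseˡ σ j)) hⱼ))
    (λ h → let i , hᵢ = anyFin⁻ (p ∘ to σ) h in anyFin⁺ p (to σ i) hᵢ))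

allSubsets-complete : ∀ n (D : Subset n) → D ∈ allSubsets n
allSubsets-complete zero [] = here refl
allSubsets-complete (suc n) (true ∷ D) = ∈.∈-++⁺ˡ (∈.∈-map⁺ (true ∷_) (allSubsets-complete n D))
allSubsets-complete (suc n) (false ∷ D) = ∈.∈-++⁺ʳ _ (∈.∈-map⁺ (false ∷_) (allSubsets-complete n D))

allSubsets-unique : ∀ n → Unique (allSubsets n)
allSubsets-unique zero = [] ∷ []
allSubsets-unique (suc n) = Unique.++⁺ (Unique.map⁺ ∷-injectiveʳ (allSubsets-unique n))
  (Unique.map⁺ ∷-injectiveʳ (allSubsets-unique n)) disjoint
  where
  ∷-injectiveʳ : ∀ {b} {D E : Subset n} → b Vec.∷ D ≡ b ∷ E → D ≡ E
  ∷-injectiveʳ refl = refl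
  disjoint : ∀ {D} → ¬ (D ∈ List.map (true ∷_) (allSubsets n) × D ∈ List.map (false ∷_) (allSubsets n))
  disjoint (p , q) with ∈.∈-map⁻ (true ∷_) p | ∈.∈-map⁻ (false ∷_) q
  ... | _ , _ , refl | _ , _ , ()

countSubsets : ∀ n → (Subset n → Bool) → ℕ
countSubsets n p = countᵇ p (allSubsets n)

countSubsets-suc : ∀ n (p : Subset (suc n) → Bool) →
  countSubsets (suc n) p ≡ countSubsets n (p ∘ (true ∷_)) + countSubsets n (p ∘ (false ∷_))
countSubsets-suc n p = trans (countᵇ-++ p (List.map (true ∷_) (allSubsets n)) _)
  (cong₂ _+_ (countᵇ-map p (true ∷_) (allSubsets n)) (countᵇ-map p (false ∷_) (allSubsets n)))

countSubsets-cong : ∀ n {p q : Subset n → Bool} → (∀ D → p D ≡ q D) → countSubsets n p ≡ countSubsets n q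
countSubsets-cong n e = countᵇ-cong e (allSubsets n)

countSubsets-none : ∀ n {p : Subset n → Bool} → (∀ D → p D ≡ false) → countSubsets n p ≡ 0
countSubsets-none n e = countᵇ-none e (allSubsets n)

countSubsets-↔ : ∀ n (p : Subset n → Bool) (σ : Subset n ↔ Subset n) →
  countSubsets n p ≡ countSubsets n (p ∘ to σ)
countSubsets-↔ n p = countᵇ-↔ p (allSubsets-unique n) (allSubsets-complete n)

countᵇ-tabulate : ∀ {A : Set} {n} (p : A → Bool) (f : Fin n → A) →
  countᵇ p (List.tabulate f) ≡ ∣ tabulate (p ∘ f) ∣
countᵇ-tabulate {n = zero} p f = refl
countᵇ-tabulate {n = suc n} p f with p (f zero)
... | true = cong suc (countᵇ-tabulate p (f ∘ suc))
... | false = countᵇ-tabulate p (f ∘ suc)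

preimage : ∀ {m n} → (Fin m → Fin n) → Subset n → Subset m
preimage f D = tabulate (lookup D ∘ f)

module _ {n} (σ : Fin n ↔ Fin n) where

  preimage-↔ : Subset n ↔ Subset n
  preimage-↔ = mk↔ₛ′ (preimage (to σ)) (preimage (from σ))
    (preimage-inverse (Inverse.strictlyInverseʳ σ)) (preimage-inverse (Inverse.strictlyInverseˡ σ))
    where
    preimage-inverse : ∀ {f g : Fin n → Fin n} → (∀ x → g (f x) ≡ x) → ∀ D → preimage f (preimage g D) ≡ D
    preimage-inverse {f} {g} gf D = trans
      (Vec.tabulate-cong (λ x → trans (Vec.lookup∘tabulate (lookup D ∘ g) (f x)) (cong (lookup D) (gf x))))
      (Vec.tabulate∘lookup D)

  ∣preimage∣ : ∀ D → ∣ preimage (to σ) D ∣ ≡ ∣ D ∣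
  ∣preimage∣ D = begin
    ∣ tabulate (lookup D ∘ to σ) ∣             ≡⟨ countᵇ-tabulate (lookup D ∘ to σ) id ⟨
    countᵇ (lookup D ∘ to σ) (List.allFin n)  ≡⟨ countᵇ-↔ (lookup D) (Unique.allFin⁺ n) ∈.∈-allFin σ ⟨
    countᵇ (lookup D) (List.allFin n)         ≡⟨ countᵇ-tabulate (lookup D) id ⟩
    ∣ tabulate (lookup D) ∣                    ≡⟨ cong ∣_∣ (Vec.tabulate∘lookup D) ⟩
    ∣ D ∣                                      ∎
    where open ≡-Reasoning

module _ {A : Set} (f : A → ℕ) where

  foldr-⊓-≤ : ∀ b {x} xs → x ∈ xs → foldr (λ y k → f y ⊓ k) b xs ≤ f x
  foldr-⊓-≤ b (y ∷ xs) (here refl) = ℕ.m⊓n≤m (f y) _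
  foldr-⊓-≤ b (y ∷ xs) (there x∈xs) = ℕ.≤-trans (ℕ.m⊓n≤n (f y) _) (foldr-⊓-≤ b xs x∈xs)

  foldr-⊓-≤-init : ∀ b xs → foldr (λ y k → f y ⊓ k) b xs ≤ b
  foldr-⊓-≤-init b [] = ℕ.≤-refl
  foldr-⊓-≤-init b (y ∷ xs) = ℕ.≤-trans (ℕ.m⊓n≤n (f y) _) (foldr-⊓-≤-init b xs)

  foldr-⊓-greatest : ∀ {v} b xs → v ≤ b → (∀ {x} → x ∈ xs → v ≤ f x) → v ≤ foldr (λ y k → f y ⊓ k) b xs
  foldr-⊓-greatest b [] v≤b v≤xs = v≤b
  foldr-⊓-greatest b (y ∷ xs) v≤b v≤xs =
    ℕ.⊓-glb (v≤xs (here refl)) (foldr-⊓-greatest b xs v≤b (v≤xs ∘ there))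

module _ {n} (G : Graph n) where

  γ-≤ : ∀ D → T (isDominating G D) → γ G ≤ ∣ D ∣
  γ-≤ D d = foldr-⊓-≤ ∣_∣ n (dominatingSets G)
    (∈.∈-filter⁺ (T? ∘ isDominating G) (allSubsets-complete n D) d)

  γ-≤-order : γ G ≤ n
  γ-≤-order = foldr-⊓-≤-init ∣_∣ n (dominatingSets G)

  γ-greatest : ∀ {v} → v ≤ n → (∀ D → T (isDominating G D) → v ≤ ∣ D ∣) → v ≤ γ G
  γ-greatest v≤n v≤dom = foldr-⊓-greatest ∣_∣ n (dominatingSets G) v≤n
    (λ {D} D∈ → v≤dom D (proj₂ (∈.∈-filter⁻ (T? ∘ isDominating G) {xs = allSubsets n} D∈)))

  γ-minimum : ∀ D → T (isDominating G D) → (∀ E → T (isDominating G E) → ∣ D ∣ ≤ ∣ E ∣) → γ G ≡ ∣ D ∣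
  γ-minimum D d minimum = ℕ.≤-antisym (γ-≤ D d) (γ-greatest (Subset.∣p∣≤n D) minimum)

  isγSet : Subset n → Bool
  isγSet D = isDominating G D ∧ ⌊ ∣ D ∣ ℕ.≟ γ G ⌋

  DV≡countSubsets : ∀ v → DV G v ≡ countSubsets n (λ D → isγSet D ∧ lookup D v)
  DV≡countSubsets v = begin
    DV G v
      ≡⟨ countᵇ-filterᵇ (λ D → ⌊ ∣ D ∣ ℕ.≟ γ G ⌋) (λ D → lookup D v) (dominatingSets G) ⟩
    countᵇ (λ D → ⌊ ∣ D ∣ ℕ.≟ γ G ⌋ ∧ lookup D v) (dominatingSets G)
      ≡⟨ countᵇ-filterᵇ (isDominating G) _ (allSubsets n) ⟩
    countSubsets n (λ D → isDominating G D ∧ (⌊ ∣ D ∣ ℕ.≟ γ G ⌋ ∧ lookup D v))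
      ≡⟨ countSubsets-cong n (λ D → sym (Bool.∧-assoc (isDominating G D) _ _)) ⟩
    countSubsets n (λ D → isγSet D ∧ lookup D v) ∎
    where open ≡-Reasoning

≅-sym : ∀ {n} (G H : Graph n) → G ≅ H → H ≅ G
≅-sym G H (σ , hom) = ↔-sym σ , λ u v → begin
  adj H u v                                   ≡⟨ cong₂ (adj H) (Inverse.strictlyInverseˡ σ u) (Inverse.strictlyInverseˡ σ v) ⟨
  adj H (to σ (from σ u)) (to σ (from σ v))   ≡⟨ hom (from σ u) (from σ v) ⟨
  adj G (from σ u) (from σ v)                 ∎
  where open ≡-Reasoning

module _ {n} (G H : Graph n) (iso : G ≅ H) where
  private
    σ = proj₁ iso
    hom = proj₂ iso

  isDominating-preimage : ∀ D → isDominating G (preimage (to σ) D) ≡ isDominating H D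
  isDominating-preimage D = begin
    isDominating G (preimage (to σ) D)
      ≡⟨ allFin-cong (λ v → cong₂ _∨_ (lookup-preimage v)
           (anyFin-cong (λ u → cong₂ _∧_ (lookup-preimage u) (hom v u)))) ⟩
    allFin (λ v → lookup D (to σ v) ∨ anyFin (λ u → lookup D (to σ u) ∧ adj H (to σ v) (to σ u)))
      ≡⟨ allFin-cong (λ v → cong (lookup D (to σ v) ∨_) (anyFin-↔ σ _)) ⟨
    allFin (dominated ∘ to σ)
      ≡⟨ allFin-↔ σ dominated ⟨
    isDominating H D ∎
    where
    open ≡-Reasoning
    lookup-preimage : ∀ v → lookup (preimage (to σ) D) v ≡ lookup D (to σ v)
    lookup-preimage = Vec.lookup∘tabulate (lookup D ∘ to σ)
    dominated : Fin n → Bool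
    dominated v = lookup D v ∨ anyFin (λ u → lookup D u ∧ adj H v u)

  γ-≤-≅ : γ G ≤ γ H
  γ-≤-≅ = γ-greatest H (γ-≤-order G) (λ D d → subst (γ G ≤_) (∣preimage∣ σ D)
    (γ-≤ G (preimage (to σ) D) (subst T (sym (isDominating-preimage D)) d)))

module _ {n} (G H : Graph n) (iso : G ≅ H) where
  private
    σ = proj₁ iso

  γ-≅ : γ G ≡ γ H
  γ-≅ = ℕ.≤-antisym (γ-≤-≅ G H iso) (γ-≤-≅ H G (≅-sym G H iso))

  isγSet-preimage : ∀ D → isγSet G (preimage (to σ) D) ≡ isγSet H D
  isγSet-preimage D = cong₂ _∧_ (isDominating-preimage G H iso D)
    (cong₂ (λ s g → ⌊ s ℕ.≟ g ⌋) (∣preimage∣ σ D) γ-≅)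

  DV-≅ : ∀ v → DV G v ≡ DV H (to σ v)
  DV-≅ v = begin
    DV G v
      ≡⟨ DV≡countSubsets G v ⟩
    countSubsets n (λ D → isγSet G D ∧ lookup D v)
      ≡⟨ countSubsets-↔ n _ (preimage-↔ σ) ⟩
    countSubsets n (λ D → isγSet G (preimage (to σ) D) ∧ lookup (preimage (to σ) D) v)
      ≡⟨ countSubsets-cong n (λ D → cong₂ _∧_ (isγSet-preimage D) (Vec.lookup∘tabulate (lookup D ∘ to σ) v)) ⟩
    countSubsets n (λ D → isγSet H D ∧ lookup D (to σ v))
      ≡⟨ DV≡countSubsets H (to σ v) ⟨
    DV H (to σ v) ∎
    where open ≡-Reasoning

complement-≅ : ∀ {n} (G H : Graph n) → G ≅ H → complement G ≅ complement H
complement-≅ G H (σ , hom) = σ , λ u v → cong₂ (λ u≡v uv → not u≡v ∧ not uv)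
  (sym (⌊≟⌋-injective Fin._≟_ Fin._≟_ (Injection.injective (↔⇒↣ σ)) u v)) (hom u v)

complement-involutive : ∀ {n} (G : Graph n) u v → adj (complement (complement G)) u v ≡ adj G u v
complement-involutive G u v with u Fin.≟ v
... | yes refl = sym (adj-irrefl G u)
... | no _ = Bool.not-involutive (adj G u v)

complement-≅ʳ : ∀ {n} (G H : Graph n) → complement G ≅ H → G ≅ complement H
complement-≅ʳ G H iso with complement-≅ (complement G) H iso
... | σ , hom = σ , λ u v → trans (sym (complement-involutive G u v)) (hom u v)

isDominating-cong : ∀ {n} (G H : Graph n) → (∀ u v → adj G u v ≡ adj H u v) →
  ∀ D → isDominating G D ≡ isDominating H D
isDominating-cong G H e D =
  allFin-cong (λ v → cong (lookup D v ∨_) (anyFin-cong (λ u → cong (lookup D u ∧_) (e v u))))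

withoutFirstPair : ∀ {n} → Graph (suc (suc n)) → Graph n
withoutFirstPair G = record
  { adj = λ u v → adj G (suc (suc u)) (suc (suc v))
  ; adj-sym = λ u v → adj-sym G (suc (suc u)) (suc (suc v))
  ; adj-irrefl = λ v → adj-irrefl G (suc (suc v))
  }

adj-withoutFirstPair-mK₂ : ∀ k u v → adj (withoutFirstPair (mK₂ (suc k))) u v ≡ adj (mK₂ k) u v
adj-withoutFirstPair-mK₂ k u v = cong₂ (λ u≡v same → not u≡v ∧ same)
  (trans (⌊suc≟suc⌋ (suc u) (suc v)) (⌊suc≟suc⌋ u v)) (⌊suc≟suc⌋ (quotient 2 u) (quotient 2 v))

adj-withoutFirstPair-complement-mK₂ : ∀ k u v →
  adj (withoutFirstPair (complement (mK₂ (suc k)))) u v ≡ adj (complement (mK₂ k)) u v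
adj-withoutFirstPair-complement-mK₂ k u v = cong₂ (λ u≡v uv → not u≡v ∧ not uv)
  (trans (⌊suc≟suc⌋ (suc u) (suc v)) (⌊suc≟suc⌋ u v)) (adj-withoutFirstPair-mK₂ k u v)

isDominating-withoutFirstPair-mK₂ : ∀ k D →
  isDominating (withoutFirstPair (mK₂ (suc k))) D ≡ isDominating (mK₂ k) D
isDominating-withoutFirstPair-mK₂ k =
  isDominating-cong (withoutFirstPair (mK₂ (suc k))) (mK₂ k) (adj-withoutFirstPair-mK₂ k)

-- A vertex of the first pair only sees its partner, so the pair is dominated iff D meets it.
isDominating-mK₂-suc : ∀ k a b (D : Subset (k * 2)) →
  isDominating (mK₂ (suc k)) (a ∷ b ∷ D) ≡ (a ∨ b) ∧ isDominating (mK₂ k) D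
isDominating-mK₂-suc k true true D = isDominating-withoutFirstPair-mK₂ k D
isDominating-mK₂-suc k true false D = isDominating-withoutFirstPair-mK₂ k D
isDominating-mK₂-suc k false true D = isDominating-withoutFirstPair-mK₂ k D
isDominating-mK₂-suc k false false D
  rewrite anyFin-none {p = λ j → lookup D j ∧ false} (λ j → Bool.∧-zeroʳ (lookup D j)) = refl

mK₂-dominating-≥ : ∀ k (D : Subset (k * 2)) → T (isDominating (mK₂ k) D) → k ≤ ∣ D ∣
mK₂-dominating-≥ zero D _ = z≤n
mK₂-dominating-≥ (suc k) (a ∷ b ∷ D) d with a | b | subst T (isDominating-mK₂-suc k a b D) d
... | true | true | d′ = s≤s (ℕ.m≤n⇒m≤1+n (mK₂-dominating-≥ k D d′))
... | true | false | d′ = s≤s (mK₂-dominating-≥ k D d′)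
... | false | true | d′ = s≤s (mK₂-dominating-≥ k D d′)

firstOfEachPair : ∀ k → Subset (k * 2)
firstOfEachPair zero = []
firstOfEachPair (suc k) = true ∷ false ∷ firstOfEachPair k

firstOfEachPair-dominating : ∀ k → T (isDominating (mK₂ k) (firstOfEachPair k))
firstOfEachPair-dominating zero = _
firstOfEachPair-dominating (suc k) =
  subst T (sym (isDominating-mK₂-suc k true false (firstOfEachPair k))) (firstOfEachPair-dominating k)

∣firstOfEachPair∣ : ∀ k → ∣ firstOfEachPair k ∣ ≡ k
∣firstOfEachPair∣ zero = refl
∣firstOfEachPair∣ (suc k) = cong suc (∣firstOfEachPair∣ k)

γ-mK₂ : ∀ k → γ (mK₂ k) ≡ k
γ-mK₂ k = trans
  (γ-minimum (mK₂ k) (firstOfEachPair k) (firstOfEachPair-dominating k)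
    (λ E e → subst (_≤ ∣ E ∣) (sym (∣firstOfEachPair∣ k)) (mK₂-dominating-≥ k E e)))
  (∣firstOfEachPair∣ k)

isPairTransversal : ∀ k → Subset (k * 2) → Bool
isPairTransversal zero [] = true
isPairTransversal (suc k) (a ∷ b ∷ D) = (a xor b) ∧ isPairTransversal k D

-- Choosing both vertices of a pair leaves too few vertices for the other k pairs.
dominating-mK₂-≢2+ : ∀ k D → isDominating (mK₂ k) D ∧ ⌊ suc (suc ∣ D ∣) ℕ.≟ suc k ⌋ ≡ false
dominating-mK₂-≢2+ k D with isDominating (mK₂ k) D in dominating
... | false = refl
... | true = ⌊≟⌋≡false ℕ._≟_ λ e →
  ℕ.<⇒≢ (s≤s (mK₂-dominating-≥ k D (subst T (sym dominating) _))) (sym (ℕ.suc-injective e))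

minimumDominating-mK₂ : ∀ k D → isDominating (mK₂ k) D ∧ ⌊ ∣ D ∣ ℕ.≟ k ⌋ ≡ isPairTransversal k D
minimumDominating-mK₂ zero [] = refl
minimumDominating-mK₂ (suc k) (a ∷ b ∷ D) rewrite isDominating-mK₂-suc k a b D with a | b
... | true | true = dominating-mK₂-≢2+ k D
... | true | false = trans (cong (isDominating (mK₂ k) D ∧_) (⌊suc≟suc⌋ℕ ∣ D ∣ k)) (minimumDominating-mK₂ k D)
... | false | true = trans (cong (isDominating (mK₂ k) D ∧_) (⌊suc≟suc⌋ℕ ∣ D ∣ k)) (minimumDominating-mK₂ k D)
... | false | false = refl

countSubsets-pair : ∀ n (p : Subset (suc (suc n)) → Bool) → countSubsets (suc (suc n)) p ≡
  (countSubsets n (p ∘ λ D → true ∷ true ∷ D) + countSubsets n (p ∘ λ D → true ∷ false ∷ D))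
  + (countSubsets n (p ∘ λ D → false ∷ true ∷ D) + countSubsets n (p ∘ λ D → false ∷ false ∷ D))
countSubsets-pair n p =
  trans (countSubsets-suc (suc n) p) (cong₂ _+_ (countSubsets-suc n _) (countSubsets-suc n _))

countSubsets-pairTransversal : ∀ k → countSubsets (k * 2) (isPairTransversal k) ≡ 2 ^ k
countSubsets-pairTransversal zero = refl
countSubsets-pairTransversal (suc k) = trans (countSubsets-pair (k * 2) _)
  (cong₂ _+_ (cong₂ _+_ (countSubsets-none (k * 2) λ _ → refl) (countSubsets-pairTransversal k))
             (cong₂ _+_ (countSubsets-pairTransversal k) (countSubsets-none (k * 2) λ _ → refl)))

countSubsets-pairTransversal-∋ : ∀ k w →
  countSubsets (suc k * 2) (λ D → isPairTransversal (suc k) D ∧ lookup D w) ≡ 2 ^ k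
countSubsets-pairTransversal-∋ k zero = trans (countSubsets-pair (k * 2) _)
  (trans (cong₂ _+_
    (cong₂ _+_ (countSubsets-none (k * 2) λ _ → refl)
               (trans (countSubsets-cong (k * 2) λ D → Bool.∧-identityʳ _) (countSubsets-pairTransversal k)))
    (cong₂ _+_ (countSubsets-none (k * 2) λ D → Bool.∧-zeroʳ _) (countSubsets-none (k * 2) λ _ → refl)))
  (ℕ.+-identityʳ (2 ^ k)))
countSubsets-pairTransversal-∋ k (suc zero) = trans (countSubsets-pair (k * 2) _)
  (trans (cong₂ _+_
    (cong₂ _+_ (countSubsets-none (k * 2) λ _ → refl) (countSubsets-none (k * 2) λ D → Bool.∧-zeroʳ _))
    (cong₂ _+_ (trans (countSubsets-cong (k * 2) λ D → Bool.∧-identityʳ _) (countSubsets-pairTransversal k))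
               (countSubsets-none (k * 2) λ _ → refl)))
  (ℕ.+-identityʳ (2 ^ k)))
countSubsets-pairTransversal-∋ (suc k) (suc (suc w)) = trans (countSubsets-pair (suc k * 2) _)
  (cong₂ _+_ (cong₂ _+_ (countSubsets-none (suc k * 2) λ _ → refl) (countSubsets-pairTransversal-∋ k w))
             (cong₂ _+_ (countSubsets-pairTransversal-∋ k w) (countSubsets-none (suc k * 2) λ _ → refl)))

isγSet-mK₂ : ∀ k D → isγSet (mK₂ k) D ≡ isPairTransversal k D
isγSet-mK₂ k D = trans
  (cong (λ γ′ → isDominating (mK₂ k) D ∧ ⌊ ∣ D ∣ ℕ.≟ γ′ ⌋) (γ-mK₂ k)) (minimumDominating-mK₂ k D)

DV-mK₂ : ∀ k w → DV (mK₂ (suc k)) w ≡ 2 ^ k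
DV-mK₂ k w = begin
  DV (mK₂ (suc k)) w
    ≡⟨ DV≡countSubsets (mK₂ (suc k)) w ⟩
  countSubsets (suc k * 2) (λ D → isγSet (mK₂ (suc k)) D ∧ lookup D w)
    ≡⟨ countSubsets-cong (suc k * 2) (λ D → cong (_∧ lookup D w) (isγSet-mK₂ (suc k) D)) ⟩
  countSubsets (suc k * 2) (λ D → isPairTransversal (suc k) D ∧ lookup D w)
    ≡⟨ countSubsets-pairTransversal-∋ k w ⟩
  2 ^ k ∎
  where open ≡-Reasoning

size0-∌ : ∀ {n} (D : Subset n) i → ⌊ ∣ D ∣ ℕ.≟ 0 ⌋ ∧ lookup D i ≡ false
size0-∌ (true ∷ D) zero = refl
size0-∌ (true ∷ D) (suc i) = refl
size0-∌ (false ∷ D) zero = Bool.∧-zeroʳ _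
size0-∌ (false ∷ D) (suc i) = size0-∌ D i

countSubsets-size : ∀ n k → countSubsets n (λ D → ⌊ ∣ D ∣ ℕ.≟ k ⌋) ≡ n C k
countSubsets-size zero zero = refl
countSubsets-size zero (suc k) = refl
countSubsets-size (suc n) zero =
  trans (countSubsets-suc n _) (cong₂ _+_ (countSubsets-none n λ _ → refl) (countSubsets-size n zero))
countSubsets-size (suc n) (suc k) = begin
  countSubsets (suc n) (λ D → ⌊ ∣ D ∣ ℕ.≟ suc k ⌋)
    ≡⟨ countSubsets-suc n _ ⟩
  countSubsets n (λ D → ⌊ suc ∣ D ∣ ℕ.≟ suc k ⌋) + countSubsets n (λ D → ⌊ ∣ D ∣ ℕ.≟ suc k ⌋)
    ≡⟨ cong₂ _+_ (trans (countSubsets-cong n (λ D → ⌊suc≟suc⌋ℕ ∣ D ∣ k)) (countSubsets-size n k))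
                 (countSubsets-size n (suc k)) ⟩
  n C k + n C suc k
    ≡⟨ nCk+nC[k+1]≡[n+1]C[k+1] n k ⟩
  suc n C suc k ∎
  where open ≡-Reasoning

countSubsets-size-∋ : ∀ n k i → countSubsets (suc n) (λ D → ⌊ ∣ D ∣ ℕ.≟ suc k ⌋ ∧ lookup D i) ≡ n C k
countSubsets-size-∋ n k zero = trans (countSubsets-suc n _)
  (trans (cong₂ _+_ (trans (countSubsets-cong n λ D → trans (Bool.∧-identityʳ _) (⌊suc≟suc⌋ℕ ∣ D ∣ k))
                           (countSubsets-size n k))
                    (countSubsets-none n λ D → Bool.∧-zeroʳ _))
         (ℕ.+-identityʳ (n C k)))
countSubsets-size-∋ (suc n) zero (suc i) = trans (countSubsets-suc (suc n) _)
  (cong₂ _+_ (countSubsets-none (suc n) λ D → trans (cong (_∧ lookup D i) (⌊suc≟suc⌋ℕ ∣ D ∣ 0)) (size0-∌ D i))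
             (countSubsets-size-∋ n zero i))
countSubsets-size-∋ (suc n) (suc k) (suc i) = trans (countSubsets-suc (suc n) _)
  (trans (cong₂ _+_ (trans (countSubsets-cong (suc n) λ D → cong (_∧ lookup D i) (⌊suc≟suc⌋ℕ ∣ D ∣ (suc k)))
                           (countSubsets-size-∋ n k i))
                    (countSubsets-size-∋ n (suc k) i))
         (nCk+nC[k+1]≡[n+1]C[k+1] n k))

anyFin-lookup : ∀ {n} (D : Subset n) → anyFin (lookup D) ≡ (1 ≤ᵇ ∣ D ∣)
anyFin-lookup [] = refl
anyFin-lookup (true ∷ D) = refl
anyFin-lookup (false ∷ D) = anyFin-lookup D

module _ {n} (D : Subset n) where

  anyFin-lookup∧true : anyFin (λ i → lookup D i ∧ true) ≡ (1 ≤ᵇ ∣ D ∣)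
  anyFin-lookup∧true = trans (anyFin-cong λ i → Bool.∧-identityʳ (lookup D i)) (anyFin-lookup D)

  allFin-lookup∨true : allFin (λ i → lookup D i ∨ true) ≡ true
  allFin-lookup∨true = allFin-all λ i → Bool.∨-zeroʳ (lookup D i)

isDominating-complement-mK₂ : ∀ k D → isDominating (complement (mK₂ (suc k))) D ≡ (2 ≤ᵇ ∣ D ∣)
isDominating-complement-mK₂ k (true ∷ true ∷ D) = allFin-lookup∨true D
isDominating-complement-mK₂ k (true ∷ false ∷ D) =
  trans (cong₂ _∧_ (anyFin-lookup∧true D) (allFin-lookup∨true D)) (Bool.∧-identityʳ _)
isDominating-complement-mK₂ k (false ∷ true ∷ D) =
  trans (cong₂ _∧_ (anyFin-lookup∧true D) (allFin-lookup∨true D)) (Bool.∧-identityʳ _)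
isDominating-complement-mK₂ zero (false ∷ false ∷ []) = refl
isDominating-complement-mK₂ (suc k) (false ∷ false ∷ D) = begin
  isDominating (complement (mK₂ (suc (suc k)))) (false ∷ false ∷ D)
    ≡⟨ cong₂ _∧_ (anyFin-lookup∧true D) (cong₂ _∧_ (anyFin-lookup∧true D) (trans
         (isDominating-cong (withoutFirstPair (complement (mK₂ (suc (suc k))))) (complement (mK₂ (suc k)))
           (adj-withoutFirstPair-complement-mK₂ (suc k)) D)
         (isDominating-complement-mK₂ k D))) ⟩
  (1 ≤ᵇ ∣ D ∣) ∧ ((1 ≤ᵇ ∣ D ∣) ∧ (2 ≤ᵇ ∣ D ∣))
    ≡⟨ 1≤ᵇ∧2≤ᵇ ∣ D ∣ ⟩
  (2 ≤ᵇ ∣ D ∣) ∎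
  where
  open ≡-Reasoning
  1≤ᵇ∧2≤ᵇ : ∀ s → (1 ≤ᵇ s) ∧ ((1 ≤ᵇ s) ∧ (2 ≤ᵇ s)) ≡ (2 ≤ᵇ s)
  1≤ᵇ∧2≤ᵇ zero = refl
  1≤ᵇ∧2≤ᵇ (suc zero) = refl
  1≤ᵇ∧2≤ᵇ (suc (suc s)) = refl

γ-complement-mK₂ : ∀ k → γ (complement (mK₂ (suc k))) ≡ 2
γ-complement-mK₂ k = trans
  (γ-minimum (complement (mK₂ (suc k))) firstPair
    (subst T (sym (isDominating-complement-mK₂ k firstPair)) _)
    (λ E e → subst (_≤ ∣ E ∣) (sym ∣firstPair∣)
      (ℕ.≤ᵇ⇒≤ 2 ∣ E ∣ (subst T (isDominating-complement-mK₂ k E) e))))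
  ∣firstPair∣
  where
  firstPair : Subset (suc k * 2)
  firstPair = true ∷ true ∷ ⊥
  ∣firstPair∣ : ∣ firstPair ∣ ≡ 2
  ∣firstPair∣ = cong (λ s → 2 + s) (Subset.∣⊥∣≡0 (k * 2))

isγSet-complement-mK₂ : ∀ k D → isγSet (complement (mK₂ (suc k))) D ≡ ⌊ ∣ D ∣ ℕ.≟ 2 ⌋
isγSet-complement-mK₂ k D = trans
  (cong₂ (λ dominating γ′ → dominating ∧ ⌊ ∣ D ∣ ℕ.≟ γ′ ⌋) (isDominating-complement-mK₂ k D) (γ-complement-mK₂ k))
  (size2 ∣ D ∣)
  where
  size2 : ∀ s → (2 ≤ᵇ s) ∧ ⌊ s ℕ.≟ 2 ⌋ ≡ ⌊ s ℕ.≟ 2 ⌋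
  size2 zero = refl
  size2 (suc zero) = refl
  size2 (suc (suc s)) = refl

DV-complement-mK₂ : ∀ k w → DV (complement (mK₂ (suc k))) w ≡ suc k * 2 ∸ 1
DV-complement-mK₂ k w = begin
  DV (complement (mK₂ (suc k))) w
    ≡⟨ DV≡countSubsets (complement (mK₂ (suc k))) w ⟩
  countSubsets (suc k * 2) (λ D → isγSet (complement (mK₂ (suc k))) D ∧ lookup D w)
    ≡⟨ countSubsets-cong (suc k * 2) (λ D → cong (_∧ lookup D w) (isγSet-complement-mK₂ k D)) ⟩
  countSubsets (suc k * 2) (λ D → ⌊ ∣ D ∣ ℕ.≟ 2 ⌋ ∧ lookup D w)
    ≡⟨ countSubsets-size-∋ (suc (k * 2)) 1 w ⟩
  suc (k * 2) C 1
    ≡⟨ nC1≡n (suc (k * 2)) ⟩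
  suc k * 2 ∸ 1 ∎
  where open ≡-Reasoning

proposition2p8 : (m : ℕ) → 2 ≤ m → (G : Graph (m * 2)) →
    (G ≅ mK₂ m) ⊎ (complement G ≅ mK₂ m) →
    (v : Fin (m * 2)) →
    DV G v + DV (complement G) v ≡ (m * 2 ∸ 1) + 2 ^ (m ∸ 1)
proposition2p8 zero ()
proposition2p8 (suc k) _ G (inj₁ G≅mK₂) v = begin
  DV G v + DV (complement G) v
    ≡⟨ cong₂ _+_ (DV-≅ G K G≅mK₂ v) (DV-≅ (complement G) (complement K) (complement-≅ G K G≅mK₂) v) ⟩
  DV K w + DV (complement K) w
    ≡⟨ cong₂ _+_ (DV-mK₂ k w) (DV-complement-mK₂ k w) ⟩
  2 ^ k + (suc k * 2 ∸ 1)
    ≡⟨ ℕ.+-comm (2 ^ k) (suc k * 2 ∸ 1) ⟩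
  (suc k * 2 ∸ 1) + 2 ^ k ∎
  where
  open ≡-Reasoning
  K = mK₂ (suc k)
  w = to (proj₁ G≅mK₂) v
proposition2p8 (suc k) _ G (inj₂ Ḡ≅mK₂) v = cong₂ _+_
  (trans (DV-≅ G (complement K) (complement-≅ʳ G K Ḡ≅mK₂) v) (DV-complement-mK₂ k w))
  (trans (DV-≅ (complement G) K Ḡ≅mK₂ v) (DV-mK₂ k w))
  where
  K = mK₂ (suc k)
  w = to (proj₁ Ḡ≅mK₂) v
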